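{- Let $\mathfrak F$ be the dual frame of a subdirectly irreducible $\mathsf{M^{+}S4}$-algebra, with $d(\mathfrak F)=h$ finite. Then $T(\mathfrak F)=D_h(\mathfrak F)$ and $D_h(\mathfrak F)$ is clopen.
   Context: A descriptive $\mathsf{MS4}$-frame $\mathfrak F=(X,R,E)$: Stone space, continuous quasi-order $R$, continuous equivalence $E$, $RE\subseteq ER$. $\mathsf{M^{+}S4}=\mathsf{MS4}+\mathsf{M^{+}Cas}$ with $\mathsf{M^{+}Cas}=\square\forall(\square(\square p\to\square\forall p)\to\square\forall p)\to\square\forall p$. $Q=ER$ (the dual relation of $\lozenge\exists$). $T(\mathfrak F)=\{x: Q(x)=X\}$ is the set of $Q$-roots; an $\mathsf{MS4}$-algebra is s.i. iff its dual frame is strongly $Q$-rooted, i.e. $T(\mathfrak F)$ is nonempty and open. $d(\mathfrak F)$ is the $R$-depth; layers $D_0=\varnothing$, $D_{n+1}=\operatorname{qmax}(X-\bigcup_{i\le n}D_i)$, where $\operatorname{qmax}A=\{x\in A:xRy,y\in A\Rightarrow yRx\}$. -}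

module Defs where

open import Level using (Level; _⊔_) renaming (zero to lzero; suc to lsuc)
open import Data.Nat using (ℕ; zero; suc)
open import Data.Product using (Σ; _×_; _,_; ∃)
open import Data.Sum using (_⊎_)
open import Data.Empty using (⊥)
open import Data.Unit using (⊤)
open import Data.List using (List)
open import Data.List.Membership.Propositional using (_∈_)
open import Relation.Nullary using (¬_)
open import Relation.Binary.PropositionalEquality using (_≡_)

Subset : Set → Set₁
Subset X = X → Set

module _ {X : Set} where
  _∩_ : Subset X → Subset X → Subset X
  (U ∩ V) x = U x × V x

  ∁ : Subset X → Subset X
  ∁ U x = ¬ U x

  _⊆_ : Subset X → Subset X → Set
  U ⊆ V = ∀ x → U x → V x

  _≐_ : Subset X → Subset X → Set
  U ≐ V = (U ⊆ V) × (V ⊆ U)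

record Topology (X : Set) : Set₁ where
  field
    Open     : Subset X → Set
    open-ext : ∀ {U V} → U ≐ V → Open U → Open V
    open-X   : Open (λ _ → ⊤)
    open-∩   : ∀ {U V} → Open U → Open V → Open (U ∩ V)
    open-⋃   : {I : Set} (U : I → Subset X) → (∀ i → Open (U i)) →
               Open (λ x → Σ I λ i → U i x)

  Closed : Subset X → Set
  Closed U = Open (∁ U)

  Clopen : Subset X → Set
  Clopen U = Open U × Closed U

record StoneSpace (X : Set) : Set₁ where
  field
    top : Topology X
  open Topology top public
  field
    compact : {I : Set} (U : I → Subset X) → (∀ i → Open (U i)) →
              (∀ x → Σ I λ i → U i x) →
              Σ (List I) λ is → ∀ x → Σ I λ i → (i ∈ is) × U i x
    hausdorff : ∀ x y → ¬ (x ≡ y) →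
              Σ (Subset X) λ U → Σ (Subset X) λ V →
                Open U × Open V × U x × V y × (∀ z → U z → V z → ⊥)
    zero-dim : ∀ U → Open U → ∀ x → U x →
              Σ (Subset X) λ C → Clopen C × C x × (C ⊆ U)

module _ {X : Set} where
  image : (X → X → Set) → X → Subset X
  image R x y = R x y

  preimage : (X → X → Set) → Subset X → Subset X
  preimage R U x = Σ X λ y → R x y × U y

record MS4Frame : Set₁ where
  field
    X     : Set
    stone : StoneSpace X
    R     : X → X → Set
    E     : X → X → Set
  open StoneSpace stone public
  field
    R-refl  : ∀ x → R x x
    R-trans : ∀ {x y z} → R x y → R y z → R x z
    E-refl  : ∀ x → E x x
    E-sym   : ∀ {x y} → E x y → E y x
    E-trans : ∀ {x y z} → E x y → E y z → E x z
    R-point-closed : ∀ x → Closed (image R x)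
    R-clopen       : ∀ U → Clopen U → Clopen (preimage R U)
    E-point-closed : ∀ x → Closed (image E x)
    E-clopen       : ∀ U → Clopen U → Clopen (preimage E U)
    -- RE ⊆ ER (composition read right-to-left, so that Q = ER is the
    -- relation of ◇∃):  x E y, y R z  ⇒  ∃ u. x R u, u E z
    RE⊆ER : ∀ {x y z} → E x y → R y z → Σ X λ u → R x u × E u z

module Frame (F : MS4Frame) where
  open MS4Frame F

  □ : Subset X → Subset X
  □ U x = ∀ y → R x y → U y

  ∀' : Subset X → Subset X
  ∀' U x = ∀ y → E x y → U y

  _⇒_ : Subset X → Subset X → Subset X
  (U ⇒ V) x = U x → V x

  M⁺Cas : Subset X → Subset X
  M⁺Cas P = □ (∀' ((□ (□ P ⇒ □ (∀' P))) ⇒ □ (∀' P))) ⇒ □ (∀' P)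

  ValidatesM⁺Cas : Set₁
  ValidatesM⁺Cas = ∀ P → Clopen P → ∀ x → M⁺Cas P x

  Q : X → X → Set
  Q x z = Σ X λ y → R x y × E y z

  T : Subset X
  T x = ∀ z → Q x z

  -- strongly Q-rooted (dual of subdirectly irreducible)
  StronglyQRooted : Set
  StronglyQRooted = (Σ X T) × Open T

  qmax : Subset X → Subset X
  qmax A x = A x × (∀ y → R x y → A y → R y x)

  Upto : ℕ → Subset X
  Upto zero    x = ⊥
  Upto (suc n) x = Upto n x ⊎ qmax (∁ (Upto n)) x

  D : ℕ → Subset X
  D zero    x = ⊥
  D (suc n) = qmax (∁ (Upto n))

  HasDepth : ℕ → Set
  HasDepth h = (∀ x → Upto h x) × Σ X (D h)

-- The heart of the argument is that M⁺Cas makes every Upto k = D₁ ∪ … ∪ D_k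
-- E-saturated. If a E b with a ∈ Upto (k+1) but b ∉ Upto (k+1), separate b from
-- the closed set Upto (k+1) by a clopen A and put p = ∁ A. Then □∀p fails at a,
-- so the premise of M⁺Cas fails at a too, which yields a point y satisfying
-- □(□p → □∀p), a point c ∈ D_{k+1} with y Q c, and c E u with u ∉ p. The points
-- above y that are Q-equivalent to c miss Upto (k+1), where □p and hence □∀p
-- would give p at u, and then by induction they miss every Upto n: a strict
-- successor of such a point either stays in the class, or lies strictly above
-- c's R-cluster and so, together with its E-class, in Upto k. This contradicts
-- finite depth.
--
-- Once Upto h is E-saturated, a Q-root t reaches a point of the deepest layer by
-- t R u E x, which keeps u and hence t out of Upto h, so T ⊆ D_{h+1}; conversely
-- a point of D_{h+1} is Q-below any root. Finally T is closed in every
-- descriptive frame and open by strong Q-rootedness.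

module Submission where

open import Defs
open import Level using (Level; 0ℓ)
open import Data.Nat using (ℕ; zero; suc)
open import Data.Product using (Σ; _×_; _,_; proj₁; proj₂)
open import Data.Sum using (_⊎_; inj₁; inj₂)
open import Data.Empty using (⊥; ⊥-elim)
open import Data.Unit using (⊤; tt)
open import Data.List using (List; []; _∷_)
open import Data.List.Membership.Propositional using (_∈_)
open import Data.List.Relation.Unary.Any using (here; there)
open import Relation.Nullary using (¬_; yes; no)
open import Relation.Binary.PropositionalEquality using (refl)
open import Axiom.ExcludedMiddle using (ExcludedMiddle)
open import Axiom.DoubleNegationElimination using (DoubleNegationElimination; em⇒dne)

module TopologyProperties {X : Set} (τ : Topology X) where
  open Topology τ

  Closed-cong : ∀ {U V} → U ≐ V → Closed U → Closed V
  Closed-cong (U⊆V , V⊆U) =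
    open-ext ((λ x x∉U x∈V → x∉U (V⊆U x x∈V)) , (λ x x∉V x∈U → x∉V (U⊆V x x∈U)))

  Open-fromNeighbourhoods : (U : Subset X) →
    (∀ x → U x → Σ (Subset X) λ N → Open N × N x × N ⊆ U) → Open U
  Open-fromNeighbourhoods U nbhd =
    open-ext ((λ { y ((x , x∈U) , y∈N) → proj₂ (proj₂ (proj₂ (nbhd x x∈U))) y y∈N })
             , (λ x x∈U → (x , x∈U) , proj₁ (proj₂ (proj₂ (nbhd x x∈U)))))
             (open-⋃ (λ p → proj₁ (nbhd (proj₁ p) (proj₂ p)))
                     (λ p → proj₁ (proj₂ (nbhd (proj₁ p) (proj₂ p)))))

  ∅-clopen : Clopen (λ _ → ⊥)
  ∅-clopen = open-ext ((λ { _ (() , _) }) , (λ _ ())) (open-⋃ {I = ⊥} (λ _ _ → ⊥) (λ ()))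
           , open-ext ((λ _ _ ()) , (λ _ _ → tt)) open-X

  finiteUnion : {I : Set} → (I → Subset X) → List I → Subset X
  finiteUnion {I} V is x = Σ I λ i → i ∈ is × V i x

  finiteUnion-clopen : {I : Set} (V : I → Subset X) → (∀ i → Clopen (V i)) →
    (is : List I) → Clopen (finiteUnion V is)
  finiteUnion-clopen {I} V V-clopen is =
    open-ext ((λ { x ((i , i∈) , x∈V) → i , i∈ , x∈V }) , (λ { x (i , i∈ , x∈V) → (i , i∈) , x∈V }))
             (open-⋃ (λ (j : Σ I (_∈ is)) → V (proj₁ j)) (λ j → proj₁ (V-clopen (proj₁ j))))
    , closed is
    where
      closed : (is : List I) → Closed (finiteUnion V is)
      closed []       = open-ext ((λ { _ _ (_ , () , _) }) , (λ _ _ → tt)) open-X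
      closed (i ∷ is) = open-ext (∁∩∁⊆∁ , ∁⊆∁∩∁) (open-∩ (proj₂ (V-clopen i)) (closed is))
        where
          ∁∩∁⊆∁ : (∁ (V i) ∩ ∁ (finiteUnion V is)) ⊆ ∁ (finiteUnion V (i ∷ is))
          ∁∩∁⊆∁ x (x∉Vi , _)   (_ , here refl , x∈V) = x∉Vi x∈V
          ∁∩∁⊆∁ x (_ , x∉rest) (j , there j∈ , x∈V) = x∉rest (j , j∈ , x∈V)

          ∁⊆∁∩∁ : ∁ (finiteUnion V (i ∷ is)) ⊆ (∁ (V i) ∩ ∁ (finiteUnion V is))
          ∁⊆∁∩∁ x x∉ = (λ x∈V → x∉ (i , here refl , x∈V))
                     , (λ { (j , j∈ , x∈V) → x∉ (j , there j∈ , x∈V) })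

module StoneSpaceProperties (lem : ExcludedMiddle 0ℓ) {X : Set} (𝕏 : StoneSpace X) where
  open StoneSpace 𝕏
  open TopologyProperties top

  private
    dne : DoubleNegationElimination 0ℓ
    dne = em⇒dne lem

  ∁-clopen : ∀ {U} → Clopen U → Clopen (∁ U)
  ∁-clopen (U-open , U-closed) =
    U-closed , open-ext ((λ x x∈U x∉U → x∉U x∈U) , (λ x → dne)) U-open

  clopen-between : ∀ {C U} → Closed C → Open U → C ⊆ U →
    Σ (Subset X) λ W → Clopen W × C ⊆ W × W ⊆ U
  clopen-between {C} {U} C-closed U-open C⊆U =
    finiteUnion piece is , finiteUnion-clopen piece piece-clopen is , C⊆W , W⊆U
    where
      nbhd : (p : Σ X C) → Σ (Subset X) λ V → Clopen V × V (proj₁ p) × V ⊆ U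
      nbhd (x , x∈C) = zero-dim U U-open x (C⊆U x x∈C)

      cover : Σ X C ⊎ ⊤ → Subset X
      cover (inj₁ p) = proj₁ (nbhd p)
      cover (inj₂ _) = ∁ C

      covers : ∀ x → Σ (Σ X C ⊎ ⊤) λ i → cover i x
      covers x with lem {C x}
      ... | yes x∈C = inj₁ (x , x∈C) , proj₁ (proj₂ (proj₂ (nbhd (x , x∈C))))
      ... | no  x∉C = inj₂ tt , x∉C

      cover-open : ∀ i → Open (cover i)
      cover-open (inj₁ p) = proj₁ (proj₁ (proj₂ (nbhd p)))
      cover-open (inj₂ _) = C-closed

      subcover : Σ (List (Σ X C ⊎ ⊤)) λ is → ∀ x → Σ (Σ X C ⊎ ⊤) λ i → i ∈ is × cover i x
      subcover = compact cover cover-open covers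

      is : List (Σ X C ⊎ ⊤)
      is = proj₁ subcover

      piece : Σ X C ⊎ ⊤ → Subset X
      piece (inj₁ p) = proj₁ (nbhd p)
      piece (inj₂ _) = λ _ → ⊥

      piece-clopen : ∀ i → Clopen (piece i)
      piece-clopen (inj₁ p) = proj₁ (proj₂ (nbhd p))
      piece-clopen (inj₂ _) = ∅-clopen

      C⊆W : C ⊆ finiteUnion piece is
      C⊆W x x∈C with proj₂ subcover x
      ... | inj₁ p , i∈ , x∈V = inj₁ p , i∈ , x∈V
      ... | inj₂ _ , _ , x∉C  = ⊥-elim (x∉C x∈C)

      W⊆U : finiteUnion piece is ⊆ U
      W⊆U x (inj₁ p , _ , x∈V) = proj₂ (proj₂ (proj₂ (nbhd p))) x x∈V

  preimage-closed : (S : X → X → Set) → (∀ x → Closed (image S x)) →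
    (∀ U → Clopen U → Clopen (preimage S U)) → ∀ {C} → Closed C → Closed (preimage S C)
  preimage-closed S S-point-closed S-clopen {C} C-closed =
    Open-fromNeighbourhoods (∁ (preimage S C)) nbhd
    where
      nbhd : ∀ x → ∁ (preimage S C) x →
        Σ (Subset X) λ N → Open N × N x × N ⊆ ∁ (preimage S C)
      nbhd x x∉ with clopen-between C-closed (S-point-closed x) (λ y y∈C xSy → x∉ (y , xSy , y∈C))
      ... | W , W-clopen , C⊆W , W⊆ =
        ∁ (preimage S W) , proj₂ (S-clopen W W-clopen)
        , (λ { (y , xSy , y∈W) → W⊆ y y∈W xSy })
        , (λ { z z∉ (y , zSy , y∈C) → z∉ (y , zSy , C⊆W y y∈C) })

module FrameProperties (lem : ExcludedMiddle 0ℓ) (F : MS4Frame) where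
  open MS4Frame F
  open Frame F
  open TopologyProperties top
  open StoneSpaceProperties lem stone

  private
    dne : DoubleNegationElimination 0ℓ
    dne = em⇒dne lem

  R⇒Q : ∀ {x y} → R x y → Q x y
  R⇒Q {y = y} xRy = y , xRy , E-refl y

  E⇒Q : ∀ {x y} → E x y → Q x y
  E⇒Q {x} xEy = x , R-refl x , xEy

  Q-trans : ∀ {x y z} → Q x y → Q y z → Q x z
  Q-trans (u , xRu , uEy) (v , yRv , vEz) with RE⊆ER uEy yRv
  ... | w , uRw , wEv = w , R-trans xRu uRw , E-trans wEv vEz

  T-downward : ∀ {x y} → Q x y → T y → T x
  T-downward xQy y∈T z = Q-trans xQy (y∈T z)

  Q-image-closed : ∀ x → Closed (Q x)
  Q-image-closed x =
    Closed-cong ((λ { z (y , zEy , xRy) → y , xRy , E-sym zEy })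
                , (λ { z (y , xRy , yEz) → y , E-sym yEz , xRy }))
                (preimage-closed E E-point-closed E-clopen (R-point-closed x))

  T-closed : Closed T
  T-closed = Open-fromNeighbourhoods (∁ T) nbhd
    where
      nonroot-witness : ∀ {x} → ¬ T x → Σ X λ z → ¬ Q x z
      nonroot-witness x∉T = dne λ ¬∃ → x∉T λ z → dne λ ¬xQz → ¬∃ (z , ¬xQz)

      nbhd : ∀ x → ∁ T x → Σ (Subset X) λ N → Open N × N x × N ⊆ ∁ T
      nbhd x x∉T with nonroot-witness x∉T
      ... | z , ¬xQz with zero-dim (∁ (Q x)) (Q-image-closed x) z ¬xQz
      ... | U , U-clopen , z∈U , U⊆ =
        ∁ (preimage R (preimage E U)) , proj₂ (R-clopen _ (E-clopen U U-clopen))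
        , (λ { (y , xRy , w , yEw , w∈U) → U⊆ w w∈U (y , xRy , yEw) })
        , (λ t t∉ t∈T → let (y , tRy , yEz) = t∈T z in t∉ (y , tRy , z , yEz , z∈U))

  Upset : Subset X → Set
  Upset U = ∀ {x y} → R x y → U x → U y

  E-Saturated : Subset X → Set
  E-Saturated U = ∀ {x y} → E x y → U x → U y

  Upto-upset : ∀ k → Upset (Upto k)
  Upto-upset zero _ ()
  Upto-upset (suc k) xRy (inj₁ x∈) = inj₁ (Upto-upset k xRy x∈)
  Upto-upset (suc k) {y = y} xRy (inj₂ (x∉ , maximal)) with lem {Upto k y}
  ... | yes y∈ = inj₁ y∈
  ... | no  y∉ = inj₂ (y∉ , λ w yRw w∉ → R-trans (maximal w (R-trans xRy yRw) w∉) xRy)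

  D-suc-strictSuccessor : ∀ {k x y} → D (suc k) x → R x y → ¬ R y x → Upto k y
  D-suc-strictSuccessor (_ , maximal) xRy ¬yRx = dne λ y∉ → ¬yRx (maximal _ xRy y∉)

  ∉Upto-suc⇒strictSuccessor : ∀ {k x} → ¬ Upto (suc k) x →
    Σ X λ y → R x y × ¬ Upto k y × ¬ R y x
  ∉Upto-suc⇒strictSuccessor x∉ = dne λ ¬∃ →
    x∉ (inj₂ ( (λ x∈ → x∉ (inj₁ x∈))
             , λ y xRy y∉ → dne λ ¬yRx → ¬∃ (y , xRy , y∉ , ¬yRx)))

  Upto-closed : ∀ k → Closed (Upto k)
  Upto-closed zero    = proj₂ ∅-clopen
  Upto-closed (suc k) = Open-fromNeighbourhoods (∁ (Upto (suc k))) nbhd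
    where
      nbhd : ∀ x → ∁ (Upto (suc k)) x → Σ (Subset X) λ N → Open N × N x × N ⊆ ∁ (Upto (suc k))
      nbhd x x∉ with ∉Upto-suc⇒strictSuccessor x∉
      ... | y , xRy , y∉ , ¬yRx with zero-dim (∁ (R y)) (R-point-closed y) x ¬yRx
      ... | C , C-clopen , x∈C , C⊆ with zero-dim (∁ (Upto k) ∩ ∁ (preimage R C))
                                                  (open-∩ (Upto-closed k) (proj₂ (R-clopen C C-clopen)))
                                                  y (y∉ , λ { (v , yRv , v∈C) → C⊆ v v∈C yRv })
      ... | V , V-clopen , y∈V , V⊆ =
        (C ∩ preimage R V) , open-∩ (proj₁ C-clopen) (proj₁ (R-clopen V V-clopen))
        , (x∈C , y , xRy , y∈V) , N⊆
        where
          N⊆ : (C ∩ preimage R V) ⊆ ∁ (Upto (suc k))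
          N⊆ z (z∈C , v , zRv , v∈V) (inj₁ z∈) = proj₁ (V⊆ v v∈V) (Upto-upset k zRv z∈)
          N⊆ z (z∈C , v , zRv , v∈V) (inj₂ (_ , maximal)) =
            proj₂ (V⊆ v v∈V) (z , maximal v zRv (proj₁ (V⊆ v v∈V)) , z∈C)

  Q-class-above : X → X → Subset X
  Q-class-above y c w = R y w × Q w c × Q c w

  Q-class-above-inhabited : ∀ {y c} → Q y c → Σ X (Q-class-above y c)
  Q-class-above-inhabited (w , yRw , wEc) = w , yRw , E⇒Q wEc , E⇒Q (E-sym wEc)

  Q-class-above-avoids-Upto : ∀ {k y c} → E-Saturated (Upto k) → D (suc k) c →
    Q-class-above y c ⊆ ∁ (Upto (suc k)) → ∀ n → Q-class-above y c ⊆ ∁ (Upto n)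
  Q-class-above-avoids-Upto sat c∈D shallow zero w w∈ ()
  Q-class-above-avoids-Upto sat c∈D shallow (suc n) w w∈ (inj₁ w∈Upto) =
    Q-class-above-avoids-Upto sat c∈D shallow n w w∈ w∈Upto
  Q-class-above-avoids-Upto {c = c} sat c∈D shallow (suc n) w w∈@(yRw , _ , cQw) (inj₂ w∈D)
    with ∉Upto-suc⇒strictSuccessor (shallow w w∈)
  ... | v , wRv , v∉ , ¬vRw with Q-trans cQw (R⇒Q wRv)
  ... | z , cRz , zEv with lem {R z c}
  ... | yes zRc = Q-class-above-avoids-Upto sat c∈D shallow n v
                    (R-trans yRw wRv , Q-trans (E⇒Q (E-sym zEv)) (R⇒Q zRc) , (z , cRz , zEv))
                    (D-suc-strictSuccessor w∈D wRv ¬vRw)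
  ... | no ¬zRc = v∉ (sat zEv (D-suc-strictSuccessor c∈D cRz ¬zRc))

  module _ {h : ℕ} (bounded : ∀ x → Upto h x) where

    ∀'-on-layer : ∀ {k P y c} → E-Saturated (Upto k) → Upto (suc k) ⊆ P →
      □ (□ P ⇒ □ (∀' P)) y → Q y c → D (suc k) c → ∀' P c
    ∀'-on-layer {k} {P} {y} {c} sat Upto⊆P premise yQc c∈D u cEu = dne λ ¬Pu →
      let (w , w∈) = Q-class-above-inhabited yQc in
      Q-class-above-avoids-Upto sat c∈D (λ w w∈ w∈Upto → ¬Pu (P-from-shallow w w∈ w∈Upto))
                                h w w∈ (bounded w)
      where
        P-from-shallow : ∀ w → Q-class-above y c w → Upto (suc k) w → P u
        P-from-shallow w (yRw , (z , wRz , zEc) , _) w∈ =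
          premise w yRw (λ v wRv → Upto⊆P v (Upto-upset (suc k) wRv w∈)) z wRz u (E-trans zEc cEu)

    Upto-suc⊆Cas-premise : ∀ {k P} → E-Saturated (Upto k) → Upto (suc k) ⊆ P →
      Upto (suc k) ⊆ □ (∀' (□ (□ P ⇒ □ (∀' P)) ⇒ □ (∀' P)))
    Upto-suc⊆Cas-premise {k} sat Upto⊆P a a∈ c aRc y cEy premise v yRv u vEu
      with Q-trans (E⇒Q cEy) (Q-trans (R⇒Q yRv) (E⇒Q vEu))
    ... | c′ , cRc′ , c′Eu with Upto-upset (suc k) (R-trans aRc cRc′) a∈
    ... | inj₁ c′∈Upto = Upto⊆P u (inj₁ (sat c′Eu c′∈Upto))
    ... | inj₂ c′∈D    = ∀'-on-layer sat Upto⊆P premise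
                           (Q-trans (E⇒Q (E-sym cEy)) (R⇒Q cRc′)) c′∈D u c′Eu

    Upto-saturated : ValidatesM⁺Cas → ∀ k → E-Saturated (Upto k)
    Upto-saturated valid zero _ ()
    Upto-saturated valid (suc k) {a} {b} aEb a∈ = dne λ b∉ →
      let (A , A-clopen , b∈A , A⊆) = zero-dim (∁ (Upto (suc k))) (Upto-closed (suc k)) b b∉
          Upto⊆∁A : Upto (suc k) ⊆ ∁ A
          Upto⊆∁A x x∈ x∈A = A⊆ x x∈A x∈
          □∀'∁A : □ (∀' (∁ A)) a
          □∀'∁A = valid (∁ A) (∁-clopen A-clopen) a
                    (Upto-suc⊆Cas-premise (Upto-saturated valid k) Upto⊆∁A a a∈)
      in □∀'∁A a (R-refl a) b aEb b∈A

  T⊆D-suc : ∀ {h} → E-Saturated (Upto h) → (∀ x → Upto (suc h) x) → Σ X (D (suc h)) →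
    T ⊆ D (suc h)
  T⊆D-suc sat bounded (x , x∉ , _) t t∈T with bounded t | t∈T x
  ... | inj₂ t∈D    | _             = t∈D
  ... | inj₁ t∈Upto | u , tRu , uEx = ⊥-elim (x∉ (sat uEx (Upto-upset _ tRu t∈Upto)))

  D-suc⊆T : ∀ {h} → E-Saturated (Upto h) → Σ X T → T ⊆ D (suc h) → D (suc h) ⊆ T
  D-suc⊆T sat (t , t∈T) T⊆D x (x∉ , _) with t∈T x
  ... | u , tRu , uEx = T-downward (Q-trans (E⇒Q (E-sym uEx)) (R⇒Q uRt)) t∈T
    where
      uRt : R u t
      uRt = proj₂ (T⊆D t t∈T) u tRu (λ u∈ → x∉ (sat uEx u∈))

lemma4p14 : (lem : ∀ {ℓ : Level} → ExcludedMiddle ℓ) →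
    (F : MS4Frame) → Frame.ValidatesM⁺Cas F → Frame.StronglyQRooted F →
    (h : ℕ) → Frame.HasDepth F h →
    (Frame.T F ≐ Frame.D F h) × MS4Frame.Clopen F (Frame.D F h)
lemma4p14 lem F valid _ zero (_ , _ , ())
lemma4p14 lem F valid (root , T-open) (suc h) (bounded , deepest) =
  T≐D , open-ext T≐D T-open , Closed-cong T≐D T-closed
  where
    open MS4Frame F
    open Frame F
    open TopologyProperties top
    open FrameProperties lem F

    sat : E-Saturated (Upto h)
    sat = Upto-saturated bounded valid h

    T⊆D : T ⊆ D (suc h)
    T⊆D = T⊆D-suc sat bounded deepest

    T≐D : T ≐ D (suc h)
    T≐D = T⊆D , D-suc⊆T sat root T⊆D
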